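{- There exist first-order models $\mathcal M_1$ and $\mathcal M_2$ in the same vocabulary such that $\mathcal M_1$ elementarily embeds into $\mathcal M_2$, but their ultrafilter extensions $\beta(\mathcal M_1)$ and $\beta(\mathcal M_2)$ are not elementarily equivalent.
   Context: For a set $M$, an ultrafilter $D$ on $M$ and a formula $\varphi(x,\ldots)$, write $(\forall^D x)\,\varphi(x,\ldots)$ to mean $\{a\in M:\varphi(a,\ldots)\}\in D$. For a model $\mathcal M$ with universe $M$ in a vocabulary $\tau$, its ultrafilter extension $\beta(\mathcal M)$ is the $\tau$-model whose universe $\beta(M)$ is the set of all ultrafilters on $M$, where: for an $n$-ary predicate symbol $P\in\tau$ (other than equality), $P^{\beta(\mathcal M)}=\{(D_1,\ldots,D_n):(\forall^{D_1}x_1)\ldots(\forall^{D_n}x_n)\,P^{\mathcal M}(x_1,\ldots,x_n)\}$; for an $n$-ary function symbol $F\in\tau$, $F^{\beta(\mathcal M)}(D_1,\ldots,D_n)$ is the ultrafilter $D$ on $M$ such that for every $A\subseteq M$: $A\in D$ iff $(\forall^{D_1}x_1)\ldots(\forall^{D_n}x_n)\,F^{\mathcal M}(x_1,\ldots,x_n)\in A$. -}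

module Defs where

open import Level using (Level; _⊔_; 0ℓ) renaming (suc to lsuc)
open import Data.Nat using (ℕ; zero; suc)
open import Data.Fin using (Fin; zero; suc)
open import Data.Vec.Functional using (_∷_)
open import Data.Product using (Σ; _×_; _,_)
open import Data.Sum using (_⊎_; inj₁; inj₂)
open import Data.Unit using (⊤; tt)
open import Data.Empty using (⊥; ⊥-elim)
open import Function using (_∘_)
open import Relation.Nullary using (¬_; Dec; yes; no)
open import Relation.Unary using (Pred; _⊆_; _∩_; ∁; ∅; U)
open import Relation.Binary.PropositionalEquality using (_≡_)
open import Axiom.ExcludedMiddle using (ExcludedMiddle)

-- Vocabularies (predicate and function symbols with arities; constants
-- are 0-ary function symbols; equality is built into the logic).

record Vocabulary : Set₁ where
  field
    PSym    : Set
    FSym    : Set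
    parity  : PSym → ℕ
    farity  : FSym → ℕ
open Vocabulary public

record Structure (σ : Vocabulary) : Set₁ where
  field
    Carrier : Set
    relᴹ    : (P : PSym σ) → (Fin (parity σ P) → Carrier) → Set
    funᴹ    : (F : FSym σ) → (Fin (farity σ F) → Carrier) → Carrier
open Structure public

-- A structure presented over a setoid: the symbol = is interpreted by _≈_.
-- (Used for ultrafilter extensions, whose equality is equality of
-- ultrafilters as sets of subsets, i.e. having the same members.)
record SetoidStructure (σ : Vocabulary) (a e r : Level) : Set (lsuc (a ⊔ e ⊔ r)) where
  field
    SCarrier : Set a
    _≈_      : SCarrier → SCarrier → Set e
    srel     : (P : PSym σ) → (Fin (parity σ P) → SCarrier) → Set r
    sfun     : (F : FSym σ) → (Fin (farity σ F) → SCarrier) → SCarrier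

toSetoid : ∀ {σ} → Structure σ → SetoidStructure σ 0ℓ 0ℓ 0ℓ
toSetoid M = record
  { SCarrier = Carrier M ; _≈_ = _≡_ ; srel = relᴹ M ; sfun = funᴹ M }

data Term (σ : Vocabulary) (n : ℕ) : Set where
  var : Fin n → Term σ n
  app : (F : FSym σ) → (Fin (farity σ F) → Term σ n) → Term σ n

data Formula (σ : Vocabulary) : ℕ → Set where
  eq  : ∀ {n} → Term σ n → Term σ n → Formula σ n
  rel : ∀ {n} (P : PSym σ) → (Fin (parity σ P) → Term σ n) → Formula σ n
  neg : ∀ {n} → Formula σ n → Formula σ n
  and : ∀ {n} → Formula σ n → Formula σ n → Formula σ n
  or  : ∀ {n} → Formula σ n → Formula σ n → Formula σ n
  imp : ∀ {n} → Formula σ n → Formula σ n → Formula σ n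
  all : ∀ {n} → Formula σ (suc n) → Formula σ n
  ex  : ∀ {n} → Formula σ (suc n) → Formula σ n

Sentence : Vocabulary → Set
Sentence σ = Formula σ 0

module _ {σ : Vocabulary} {a e r : Level} (S : SetoidStructure σ a e r) where
  open SetoidStructure S

  evalT : ∀ {n} → Term σ n → (Fin n → SCarrier) → SCarrier
  evalT (var i)    ρ = ρ i
  evalT (app F ts) ρ = sfun F (λ i → evalT (ts i) ρ)

  Sat : ∀ {n} → Formula σ n → (Fin n → SCarrier) → Set (a ⊔ e ⊔ r)
  Sat (eq t u)    ρ = Level.Lift (a ⊔ r) (evalT t ρ ≈ evalT u ρ)
  Sat (rel P ts)  ρ = Level.Lift (a ⊔ e) (srel P (λ i → evalT (ts i) ρ))
  Sat (neg φ)     ρ = ¬ Sat φ ρ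
  Sat (and φ ψ)   ρ = Sat φ ρ × Sat ψ ρ
  Sat (or φ ψ)    ρ = Sat φ ρ ⊎ Sat ψ ρ
  Sat (imp φ ψ)   ρ = Sat φ ρ → Sat ψ ρ
  Sat (all φ)     ρ = (x : SCarrier) → Sat φ (x ∷ ρ)
  Sat (ex φ)      ρ = Σ SCarrier (λ x → Sat φ (x ∷ ρ))

  _⊨_ : Sentence σ → Set (a ⊔ e ⊔ r)
  _⊨_ φ = Sat φ (λ ())

ElementaryEmbedding : ∀ {σ a e r a' e' r'} →
  SetoidStructure σ a e r → SetoidStructure σ a' e' r' → Set _
ElementaryEmbedding {σ} S T =
  Σ (SetoidStructure.SCarrier S → SetoidStructure.SCarrier T) λ f →
    ∀ n (φ : Formula σ n) (ρ : Fin n → SetoidStructure.SCarrier S) →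
      (Sat S φ ρ → Sat T φ (f ∘ ρ)) × (Sat T φ (f ∘ ρ) → Sat S φ ρ)

ElementarilyEquivalent : ∀ {σ a e r a' e' r'} →
  SetoidStructure σ a e r → SetoidStructure σ a' e' r' → Set _
ElementarilyEquivalent {σ} S T =
  ∀ (φ : Sentence σ) → (_⊨_ S φ → _⊨_ T φ) × (_⊨_ T φ → _⊨_ S φ)

record Filter (M : Set) : Set₁ where
  field
    mem    : Pred M 0ℓ → Set
    whole  : mem U
    proper : ¬ mem ∅
    upward : ∀ {A B : Pred M 0ℓ} → A ⊆ B → mem A → mem B
    inter  : ∀ {A B : Pred M 0ℓ} → mem A → mem B → mem (A ∩ B)

record Ultrafilter (M : Set) : Set₁ where
  field
    filter : Filter M
  open Filter filter public
  field
    ultra  : ∀ (A : Pred M 0ℓ) → mem A ⊎ mem (∁ A)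

-- The ultrafilter lemma (a consequence of the axiom of choice).
UltrafilterLemma : Set₁
UltrafilterLemma = ∀ {M : Set} (F : Filter M) →
  Σ (Ultrafilter M) λ D → ∀ {A : Pred M 0ℓ} → Filter.mem F A → Ultrafilter.mem D A

module _ {M : Set} where
  forallD : (n : ℕ) → (Fin n → Ultrafilter M) → Pred (Fin n → M) 0ℓ → Set
  forallD zero    Ds φ = φ (λ ())
  forallD (suc n) Ds φ =
    Ultrafilter.mem (Ds zero) (λ x → forallD n (λ i → Ds (suc i)) (λ xs → φ (x ∷ xs)))

  forallD-mono : ∀ n Ds {φ ψ : Pred (Fin n → M) 0ℓ} → φ ⊆ ψ → forallD n Ds φ → forallD n Ds ψ
  forallD-mono zero    Ds h p = h p
  forallD-mono (suc n) Ds h p =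
    Ultrafilter.upward (Ds zero) (forallD-mono n (λ i → Ds (suc i)) h) p

  forallD-whole : ∀ n Ds → forallD n Ds (λ _ → ⊤)
  forallD-whole zero    Ds = tt
  forallD-whole (suc n) Ds =
    Ultrafilter.upward (Ds zero) (λ _ → forallD-whole n (λ i → Ds (suc i))) (Ultrafilter.whole (Ds zero))

  forallD-inter : ∀ n Ds {φ ψ : Pred (Fin n → M) 0ℓ} →
    forallD n Ds φ → forallD n Ds ψ → forallD n Ds (φ ∩ ψ)
  forallD-inter zero    Ds p q = p , q
  forallD-inter (suc n) Ds p q =
    Ultrafilter.upward (Ds zero) (λ { (a , b) → forallD-inter n (λ i → Ds (suc i)) a b })
      (Ultrafilter.inter (Ds zero) p q)

  forallD-proper : ∀ n Ds → ¬ forallD n Ds (λ _ → ⊥)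
  forallD-proper zero    Ds ()
  forallD-proper (suc n) Ds p =
    Ultrafilter.proper (Ds zero) (Ultrafilter.upward (Ds zero) (forallD-proper n (λ i → Ds (suc i))) p)

  forallD-ultra : ExcludedMiddle 0ℓ → ∀ n Ds (φ : Pred (Fin n → M) 0ℓ) →
    forallD n Ds φ ⊎ forallD n Ds (∁ φ)
  forallD-ultra lem zero Ds φ with lem {φ (λ ())}
  ... | yes p = inj₁ p
  ... | no ¬p = inj₂ ¬p
  forallD-ultra lem (suc n) Ds φ
    with Ultrafilter.ultra (Ds zero) (λ x → forallD n (λ i → Ds (suc i)) (λ xs → φ (x ∷ xs)))
  ... | inj₁ p = inj₁ p
  ... | inj₂ q = inj₂ (Ultrafilter.upward (Ds zero) step q)
    where
      step : ∀ {x} → ¬ forallD n (λ i → Ds (suc i)) (λ xs → φ (x ∷ xs)) →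
             forallD n (λ i → Ds (suc i)) (λ xs → ¬ φ (x ∷ xs))
      step {x} nS with forallD-ultra lem n (λ i → Ds (suc i)) (λ xs → φ (x ∷ xs))
      ... | inj₁ s = ⊥-elim (nS s)
      ... | inj₂ t = t

  pushU : ExcludedMiddle 0ℓ → ∀ n → (Fin n → Ultrafilter M) → ((Fin n → M) → M) → Ultrafilter M
  pushU lem n Ds f = record
    { filter = record
      { mem    = λ A → forallD n Ds (λ xs → A (f xs))
      ; whole  = forallD-whole n Ds
      ; proper = forallD-proper n Ds
      ; upward = λ h → forallD-mono n Ds h
      ; inter  = forallD-inter n Ds
      }
    ; ultra = λ A → forallD-ultra lem n Ds (λ xs → A (f xs))
    }

-- The argument
-- lem (excluded middle) is only needed to prove that the value of a
-- function symbol is an ultrafilter; the membership relation of that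
-- value does not depend on it.

β : ∀ {σ} → ExcludedMiddle 0ℓ → Structure σ → SetoidStructure σ (lsuc 0ℓ) (lsuc 0ℓ) 0ℓ
β {σ} lem M = record
  { SCarrier = Ultrafilter (Carrier M)
  ; _≈_     = λ D E → ∀ (A : Pred (Carrier M) 0ℓ) →
                 (Ultrafilter.mem D A → Ultrafilter.mem E A) × (Ultrafilter.mem E A → Ultrafilter.mem D A)
  ; srel    = λ P Ds → forallD (parity σ P) Ds (relᴹ M P)
  ; sfun    = λ F Ds → pushU lem (farity σ F) Ds (funᴹ M F)
  }

module Submission where

-- Let ∼ be an equivalence relation and ≢ the inequality relation, both as
-- binary predicate symbols.  M₁ has infinitely many ∼-classes of every
-- finite size, M₂ is M₁ plus one infinite class.  At quantifier depth k a
-- class is only seen through the number, capped at k, of its elements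
-- outside the current parameters, so a back-and-forth argument makes M₁ an
-- elementary substructure of M₂.  In the ultrafilter extension ≢ holds of
-- (D , D) exactly when D is non-principal.  Hence β(M₂) ⊨ ∃x∃y (y ≢ y ∧ x ∼ y),
-- witnessed by a principal x on the infinite class and a non-principal y
-- concentrating on it, while in β(M₁) any y with x ∼ y concentrates on a
-- finite class and is therefore principal.

open import Level using (Level; 0ℓ; Lift; lift; lower)
open import Data.Nat using (ℕ; zero; suc; _≤_; _<_; z≤n; s≤s; _⊓_; _⊔_; _+_)
open import Data.Nat.Properties
  using (≤-refl; m≤n⇒m≤1+n; m≤n⊓o⇒m≤n; ⊓-glb; m⊔n≤o⇒m≤o; m⊔n≤o⇒n≤o;
         m≤m⊔n; m<n⇒m<o⊔n; >⇒≢; 1+n≰n; +-cancelʳ-≡; m≢1+n+m)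
open import Data.Fin using (Fin; zero; suc; punchIn; punchOut; inject≤; toℕ)
open import Data.Fin.Properties
  using (punchIn-injective; punchInᵢ≢i; punchOut-injective; inject≤-injective;
         injective⇒≤; toℕ-injective)
import Data.Fin.Properties as Fin
import Data.Nat.Properties as ℕ
open import Data.Vec.Functional using (_∷_)
open import Data.Product using (Σ; _×_; _,_; proj₁; proj₂)
open import Data.Product.Function.NonDependent.Propositional using (_×-⇔_)
open import Data.Sum using (_⊎_; inj₁; inj₂)
open import Data.Sum.Function.Propositional using (_⊎-⇔_)
open import Data.Unit using (⊤; tt)
open import Data.Empty using (⊥; ⊥-elim)
open import Function using (_∘_; id)
open import Function.Bundles using (_⇔_; mk⇔; Equivalence)
open import Function.Construct.Symmetry using (⇔-sym)
open import Function.Construct.Composition using () renaming (equivalence to infixr 5 _⟨⇔⟩_)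
open import Function.Definitions using (Injective)
open import Function.Related.TypeIsomorphisms using (→-cong-⇔; ¬-cong-⇔)
open import Relation.Nullary using (¬_; yes; no)
open import Relation.Nullary.Decidable using (toSum)
open import Relation.Unary using (Pred)
open import Relation.Binary.Structures using (IsEquivalence)
open import Relation.Binary.PropositionalEquality using (_≡_; _≢_; refl; sym; trans; cong; subst)
open import Axiom.ExcludedMiddle using (ExcludedMiddle)
open import Defs

open Equivalence using (to; from)

Lift-cong-⇔ : ∀ {ℓ} {A B : Set} → A ⇔ B → Lift ℓ A ⇔ Lift ℓ B
Lift-cong-⇔ A⇔B = mk⇔ (λ a → lift (to A⇔B (lower a))) (λ b → lift (from A⇔B (lower b)))

¬-both-⇔ : ∀ {A B : Set} → ¬ A → ¬ B → A ⇔ B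
¬-both-⇔ ¬a ¬b = mk⇔ (⊥-elim ∘ ¬a) (⊥-elim ∘ ¬b)

∷-duplicate : ∀ {A : Set} {n} (ρ : Fin n → A) j i → (ρ j ∷ ρ) i ≡ ρ ((j ∷ id) i)
∷-duplicate ρ j zero    = refl
∷-duplicate ρ j (suc i) = refl

∷-injective : ∀ {A : Set} {m} {z : A} {g : Fin m → A} →
  Injective _≡_ _≡_ g → (∀ l → g l ≢ z) → Injective _≡_ _≡_ (z ∷ g)
∷-injective g-inj g≢z {zero}  {zero}  _ = refl
∷-injective g-inj g≢z {zero}  {suc b} q = ⊥-elim (g≢z b (sym q))
∷-injective g-inj g≢z {suc a} {zero}  q = ⊥-elim (g≢z a q)
∷-injective g-inj g≢z {suc a} {suc b} q = cong suc (g-inj q)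

injective-avoiding : ExcludedMiddle 0ℓ → ∀ {A : Set} {m} {g : Fin (suc m) → A} →
  Injective _≡_ _≡_ g → (z : A) →
  Σ (Fin m → Fin (suc m)) λ r → Injective _≡_ _≡_ (g ∘ r) × (∀ l → g (r l) ≢ z)
injective-avoiding em {A} {m} {g} g-inj z with em {Σ (Fin (suc m)) λ l → g l ≡ z}
... | yes (l , gl≡z) = punchIn l , (λ q → punchIn-injective l _ _ (g-inj q))
                     , (λ t q → punchInᵢ≢i l t (g-inj (trans q (sym gl≡z))))
... | no z∉g         = suc , (λ q → Fin.suc-injective (g-inj q)) , (λ t q → z∉g (suc t , q))

module _ {P : Set} (_∼_ : P → P → Set) where

  Mates : P → ℕ → Set
  Mates x m = Σ (Fin m → P) λ g → Injective _≡_ _≡_ g × (∀ l → g l ∼ x) × (∀ l → g l ≢ x)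

  Spare : ∀ {n} → (Fin n → P) → Fin n → ℕ → Set
  Spare ρ i m = Σ (Fin m → P) λ g → Injective _≡_ _≡_ g × (∀ l → g l ∼ ρ i) × (∀ l j → g l ≢ ρ j)

record EquivalenceStructure : Set₁ where
  field
    Point         : Set
    _∼_           : Point → Point → Set
    isEquivalence : IsEquivalence _∼_
    mates-profile : ∀ x → (Σ ℕ λ s → ∀ m → Mates _∼_ x m ⇔ m ≤ s) ⊎ (∀ m → Mates _∼_ x m)
    new-class     : ∀ {n} (ρ : Fin n → Point) s →
                    Σ Point λ y → (∀ j → ¬ y ∼ ρ j) × (∀ m → Mates _∼_ y m ⇔ m ≤ s)

  open IsEquivalence isEquivalence public
    using () renaming (refl to ∼-refl; sym to ∼-sym; trans to ∼-trans; reflexive to ∼-reflexive)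

module ClassCounting (A : EquivalenceStructure) where
  open EquivalenceStructure A

  spare-transfer : ∀ {n n₂} {ρ : Fin n → Point} {τ : Fin n₂ → Point} {i i₂ m} →
    (∀ j₂ → Σ (Fin n) λ j → τ j₂ ≡ ρ j) → ρ i ∼ τ i₂ → Spare _∼_ ρ i m → Spare _∼_ τ i₂ m
  spare-transfer τ⊆ρ i∼i₂ (g , g-inj , g∼ , g∉) =
    g , g-inj , (λ l → ∼-trans (g∼ l) i∼i₂) , λ l j₂ q → g∉ l _ (trans q (proj₂ (τ⊆ρ j₂)))

  spare-class-cong : ∀ {n} {ρ : Fin n → Point} i i₂ {m} →
    ρ i ∼ ρ i₂ → Spare _∼_ ρ i m ⇔ Spare _∼_ ρ i₂ m
  spare-class-cong i i₂ i∼i₂ = mk⇔ (spare-transfer (λ j → j , refl) i∼i₂)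
                              (spare-transfer (λ j → j , refl) (∼-sym i∼i₂))

  spare-one : ∀ {n} {ρ : Fin n → Point} {i} →
    Spare _∼_ ρ i 1 ⇔ (Σ Point λ y → y ∼ ρ i × ∀ j → y ≢ ρ j)
  spare-one = mk⇔
    (λ (g , _ , g∼ , g∉) → g zero , g∼ zero , g∉ zero)
    (λ (y , y∼ , y∉) → (λ _ → y) , (λ { {zero} {zero} _ → refl }) , (λ _ → y∼) , λ _ → y∉)

  spare-∷-duplicate : ∀ {n} (ρ : Fin n → Point) j i {m} →
    Spare _∼_ (ρ j ∷ ρ) i m ⇔ Spare _∼_ ρ ((j ∷ id) i) m
  spare-∷-duplicate ρ j i = mk⇔
    (spare-transfer {τ = ρ} {i = i} (λ j₂ → suc j₂ , refl) (∼-reflexive (∷-duplicate ρ j i)))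
    (spare-transfer {τ = ρ j ∷ ρ} {i₂ = i} (λ j₂ → (j ∷ id) j₂ , ∷-duplicate ρ j j₂)
                    (∼-reflexive (sym (∷-duplicate ρ j i))))

  spare-∷-unrelated : ∀ {n} {ρ : Fin n → Point} {z i m} →
    ¬ z ∼ ρ i → Spare _∼_ (z ∷ ρ) (suc i) m ⇔ Spare _∼_ ρ i m
  spare-∷-unrelated {ρ = ρ} {i = i} z≁ = mk⇔
    (spare-transfer (λ j → suc j , refl) ∼-refl)
    (λ (g , g-inj , g∼ , g∉) → g , g-inj , g∼ ,
      λ { l zero q → z≁ (subst (_∼ ρ i) q (g∼ l)) ; l (suc j) → g∉ l j })

  spare-∷-related : ExcludedMiddle 0ℓ → ∀ {n} {ρ : Fin n → Point} {z i m} →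
    (∀ j → z ≢ ρ j) → z ∼ ρ i → Spare _∼_ (z ∷ ρ) (suc i) m ⇔ Spare _∼_ ρ i (suc m)
  spare-∷-related em z∉ z∼ = mk⇔
    (λ (g , g-inj , g∼ , g∉) → (_ ∷ g) , ∷-injective g-inj (λ l → g∉ l zero)
                             , (λ { zero → z∼ ; (suc l) → g∼ l })
                             , λ { zero → z∉ ; (suc l) j → g∉ l (suc j) })
    (λ (g , g-inj , g∼ , g∉) → let r , gr-inj , gr≢z = injective-avoiding em g-inj _ in
      g ∘ r , gr-inj , (g∼ ∘ r) , λ { l zero → gr≢z l ; l (suc j) → g∉ (r l) j })

  spare-new-class : ∀ {n} {ρ : Fin n → Point} {z m} →
    (∀ j → ¬ z ∼ ρ j) → Spare _∼_ (z ∷ ρ) zero m ⇔ Mates _∼_ z m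
  spare-new-class {z = z} z≁ = mk⇔
    (λ (g , g-inj , g∼ , g∉) → g , g-inj , g∼ , λ l → g∉ l zero)
    (λ (g , g-inj , g∼ , g≢) → g , g-inj , g∼ ,
      λ { l zero → g≢ l ; l (suc j) q → z≁ j (∼-sym (subst (_∼ z) q (g∼ l))) })

  mates-truncated : ∀ x k → Σ ℕ λ s → ∀ m → m ≤ k → Mates _∼_ x m ⇔ m ≤ s
  mates-truncated x k with mates-profile x
  ... | inj₁ (s , mates⇔) =
    s ⊓ k , λ m m≤k → mates⇔ m ⟨⇔⟩ mk⇔ (λ m≤s → ⊓-glb m≤s m≤k) (m≤n⊓o⇒m≤n s k)
  ... | inj₂ mates        = k , λ m m≤k → mk⇔ (λ _ → m≤k) (λ _ → mates m)

  ∼-via : ∀ {x z w} → x ∼ z → (x ∼ w) ⇔ (z ∼ w)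
  ∼-via x∼z = mk⇔ (∼-trans (∼-sym x∼z)) (∼-trans x∼z)

module _ (A B : EquivalenceStructure) where
  private
    module A = EquivalenceStructure A
    module B = EquivalenceStructure B

  -- Back-and-forth invariant for games of k more rounds.
  record Similar (k : ℕ) {n} (ρ₁ : Fin n → A.Point) (ρ₂ : Fin n → B.Point) : Set where
    field
      ≡-similar     : ∀ i j → (ρ₁ i ≡ ρ₁ j) ⇔ (ρ₂ i ≡ ρ₂ j)
      ∼-similar     : ∀ i j → (ρ₁ i A.∼ ρ₁ j) ⇔ (ρ₂ i B.∼ ρ₂ j)
      spare-similar : ∀ i m → m ≤ k → Spare A._∼_ ρ₁ i m ⇔ Spare B._∼_ ρ₂ i m

open Similar

module _ {A B : EquivalenceStructure} where
  private
    module A = EquivalenceStructure A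
    module B = EquivalenceStructure B
    module SA = ClassCounting A
    module SB = ClassCounting B

  similar-sym : ∀ {k n} {ρ₁ : Fin n → A.Point} {ρ₂ : Fin n → B.Point} →
    Similar A B k ρ₁ ρ₂ → Similar B A k ρ₂ ρ₁
  similar-sym s = record
    { ≡-similar     = λ i j → ⇔-sym (≡-similar s i j)
    ; ∼-similar     = λ i j → ⇔-sym (∼-similar s i j)
    ; spare-similar = λ i m m≤k → ⇔-sym (spare-similar s i m m≤k)
    }

  similar-∷ : ∀ {k l n} {ρ₁ : Fin n → A.Point} {ρ₂ : Fin n → B.Point} {x y} →
    Similar A B l ρ₁ ρ₂ →
    (∀ j → (x ≡ ρ₁ j) ⇔ (y ≡ ρ₂ j)) → (∀ j → (x A.∼ ρ₁ j) ⇔ (y B.∼ ρ₂ j)) →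
    (∀ i m → m ≤ k → Spare A._∼_ (x ∷ ρ₁) i m ⇔ Spare B._∼_ (y ∷ ρ₂) i m) →
    Similar A B k (x ∷ ρ₁) (y ∷ ρ₂)
  similar-∷ {ρ₁ = ρ₁} {ρ₂} {x} {y} s x≡ x∼ spare =
    record { ≡-similar = ≡-new ; ∼-similar = ∼-new ; spare-similar = spare }
    where
      ≡-new : ∀ i j → ((x ∷ ρ₁) i ≡ (x ∷ ρ₁) j) ⇔ ((y ∷ ρ₂) i ≡ (y ∷ ρ₂) j)
      ≡-new zero    zero    = mk⇔ (λ _ → refl) (λ _ → refl)
      ≡-new zero    (suc j) = x≡ j
      ≡-new (suc i) zero    = mk⇔ sym sym ⟨⇔⟩ x≡ i ⟨⇔⟩ mk⇔ sym sym
      ≡-new (suc i) (suc j) = ≡-similar s i j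
      ∼-new : ∀ i j → ((x ∷ ρ₁) i A.∼ (x ∷ ρ₁) j) ⇔ ((y ∷ ρ₂) i B.∼ (y ∷ ρ₂) j)
      ∼-new zero    zero    = mk⇔ (λ _ → B.∼-refl) (λ _ → A.∼-refl)
      ∼-new zero    (suc j) = x∼ j
      ∼-new (suc i) zero    = mk⇔ A.∼-sym A.∼-sym ⟨⇔⟩ x∼ i ⟨⇔⟩ mk⇔ B.∼-sym B.∼-sym
      ∼-new (suc i) (suc j) = ∼-similar s i j

  module Extension (em : ExcludedMiddle 0ℓ) {k n} {ρ₁ : Fin n → A.Point} {ρ₂ : Fin n → B.Point}
                   (s : Similar A B (suc k) ρ₁ ρ₂) where

    spare-weaken : ∀ i m → m ≤ k → Spare A._∼_ ρ₁ i m ⇔ Spare B._∼_ ρ₂ i m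
    spare-weaken i m m≤k = spare-similar s i m (m≤n⇒m≤1+n m≤k)

    extend-by-parameter : ∀ j → Similar A B k (ρ₁ j ∷ ρ₁) (ρ₂ j ∷ ρ₂)
    extend-by-parameter j = similar-∷ s (≡-similar s j) (∼-similar s j) λ i m m≤k →
      SA.spare-∷-duplicate ρ₁ j i ⟨⇔⟩ spare-weaken _ m m≤k ⟨⇔⟩ ⇔-sym (SB.spare-∷-duplicate ρ₂ j i)

    extend-within-class : ∀ {x} j → (∀ j → x ≢ ρ₁ j) → x A.∼ ρ₁ j →
      Σ B.Point λ y → Similar A B k (x ∷ ρ₁) (y ∷ ρ₂)
    extend-within-class {x} j x∉ x∼j
      with to SB.spare-one (to (spare-similar s j 1 (s≤s z≤n)) (from SA.spare-one (x , x∼j , x∉)))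
    ... | y , y∼j , y∉ = y , similar-∷ s (λ i → ¬-both-⇔ (x∉ i) (y∉ i)) x∼ spare
      where
        x∼ : ∀ i → (x A.∼ ρ₁ i) ⇔ (y B.∼ ρ₂ i)
        x∼ i = SA.∼-via x∼j ⟨⇔⟩ ∼-similar s j i ⟨⇔⟩ ⇔-sym (SB.∼-via y∼j)
        spare-old : ∀ i m → m ≤ k → Spare A._∼_ (x ∷ ρ₁) (suc i) m ⇔ Spare B._∼_ (y ∷ ρ₂) (suc i) m
        spare-old i m m≤k with em {x A.∼ ρ₁ i}
        ... | yes x∼i = SA.spare-∷-related em x∉ x∼i ⟨⇔⟩ spare-similar s i (suc m) (s≤s m≤k)
                        ⟨⇔⟩ ⇔-sym (SB.spare-∷-related em y∉ (to (x∼ i) x∼i))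
        ... | no x≁i  = SA.spare-∷-unrelated x≁i ⟨⇔⟩ spare-weaken i m m≤k
                        ⟨⇔⟩ ⇔-sym (SB.spare-∷-unrelated (x≁i ∘ from (x∼ i)))
        spare : ∀ i m → m ≤ k → Spare A._∼_ (x ∷ ρ₁) i m ⇔ Spare B._∼_ (y ∷ ρ₂) i m
        spare zero    m m≤k = SA.spare-class-cong zero (suc j) x∼j ⟨⇔⟩ spare-old j m m≤k
                              ⟨⇔⟩ ⇔-sym (SB.spare-class-cong zero (suc j) y∼j)
        spare (suc i) m m≤k = spare-old i m m≤k

    extend-to-new-class : ∀ {x} → (∀ j → ¬ x A.∼ ρ₁ j) →
      Σ B.Point λ y → Similar A B k (x ∷ ρ₁) (y ∷ ρ₂)
    extend-to-new-class {x} x≁ with SA.mates-truncated x k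
    ... | c , x-mates with B.new-class ρ₂ c
    ...   | y , y≁ , y-mates =
      y , similar-∷ s (λ i → ¬-both-⇔ (x≁ i ∘ A.∼-reflexive) (y≁ i ∘ B.∼-reflexive))
                      (λ i → ¬-both-⇔ (x≁ i) (y≁ i)) spare
      where
        spare : ∀ i m → m ≤ k → Spare A._∼_ (x ∷ ρ₁) i m ⇔ Spare B._∼_ (y ∷ ρ₂) i m
        spare zero    m m≤k = SA.spare-new-class x≁ ⟨⇔⟩ x-mates m m≤k
                              ⟨⇔⟩ ⇔-sym (y-mates m) ⟨⇔⟩ ⇔-sym (SB.spare-new-class y≁)
        spare (suc i) m m≤k = SA.spare-∷-unrelated (x≁ i) ⟨⇔⟩ spare-weaken i m m≤k
                              ⟨⇔⟩ ⇔-sym (SB.spare-∷-unrelated (y≁ i))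

    extend : ∀ x → Σ B.Point λ y → Similar A B k (x ∷ ρ₁) (y ∷ ρ₂)
    extend x with em {Σ (Fin n) λ j → x ≡ ρ₁ j}
    ... | yes (j , refl) = ρ₂ j , extend-by-parameter j
    ... | no x∉ with em {Σ (Fin n) λ j → x A.∼ ρ₁ j}
    ...   | yes (j , x∼j) = extend-within-class j (λ j q → x∉ (j , q)) x∼j
    ...   | no x≁         = extend-to-new-class (λ j q → x≁ (j , q))

data Symbol : Set where
  classmate distinct : Symbol

vocabulary : Vocabulary
vocabulary = record { PSym = Symbol ; FSym = ⊥ ; parity = λ _ → 2 ; farity = λ () }

structure : EquivalenceStructure → Structure vocabulary
structure A = record { Carrier = Point ; relᴹ = interpret ; funᴹ = λ () }
  where
    open EquivalenceStructure A
    interpret : Symbol → (Fin 2 → Point) → Set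
    interpret classmate v = v zero ∼ v (suc zero)
    interpret distinct  v = v zero ≢ v (suc zero)

quantifier-depth : ∀ {n} → Formula vocabulary n → ℕ
quantifier-depth (eq _ _)  = 0
quantifier-depth (rel _ _) = 0
quantifier-depth (neg φ)   = quantifier-depth φ
quantifier-depth (and φ ψ) = quantifier-depth φ ⊔ quantifier-depth ψ
quantifier-depth (or φ ψ)  = quantifier-depth φ ⊔ quantifier-depth ψ
quantifier-depth (imp φ ψ) = quantifier-depth φ ⊔ quantifier-depth ψ
quantifier-depth (all φ)   = suc (quantifier-depth φ)
quantifier-depth (ex φ)    = suc (quantifier-depth φ)

module _ {A B : EquivalenceStructure} where
  private
    module A = EquivalenceStructure A
    module B = EquivalenceStructure B
    S₁ S₂ : SetoidStructure vocabulary 0ℓ 0ℓ 0ℓ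
    S₁ = toSetoid (structure A)
    S₂ = toSetoid (structure B)

  atom-similar : ∀ {k n} (P : Symbol) (t u : Term vocabulary n)
    {ρ₁ : Fin n → A.Point} {ρ₂ : Fin n → B.Point} → Similar A B k ρ₁ ρ₂ →
    relᴹ (structure A) P (evalT S₁ t ρ₁ ∷ λ _ → evalT S₁ u ρ₁) ⇔
    relᴹ (structure B) P (evalT S₂ t ρ₂ ∷ λ _ → evalT S₂ u ρ₂)
  atom-similar classmate (var i) (var j) s = ∼-similar s i j
  atom-similar distinct  (var i) (var j) s = ¬-cong-⇔ (≡-similar s i j)
  atom-similar P (app () _) u s
  atom-similar P (var _) (app () _) s

  module _ (em : ExcludedMiddle 0ℓ) where
    sat-similar : ∀ {k n} (φ : Formula vocabulary n) (ρ₁ : Fin n → A.Point) (ρ₂ : Fin n → B.Point) →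
      quantifier-depth φ ≤ k → Similar A B k ρ₁ ρ₂ → Sat S₁ φ ρ₁ ⇔ Sat S₂ φ ρ₂
    sat-similar (eq (var i) (var j)) ρ₁ ρ₂ _ s = Lift-cong-⇔ (≡-similar s i j)
    sat-similar (eq (app () _) _) ρ₁ ρ₂ _ s
    sat-similar (eq (var _) (app () _)) ρ₁ ρ₂ _ s
    sat-similar (rel classmate ts) ρ₁ ρ₂ _ s =
      Lift-cong-⇔ (atom-similar classmate (ts zero) (ts (suc zero)) s)
    sat-similar (rel distinct ts) ρ₁ ρ₂ _ s =
      Lift-cong-⇔ (atom-similar distinct (ts zero) (ts (suc zero)) s)
    sat-similar (neg φ) ρ₁ ρ₂ d s = ¬-cong-⇔ (sat-similar φ ρ₁ ρ₂ d s)
    sat-similar (and φ ψ) ρ₁ ρ₂ d s =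
      sat-similar φ ρ₁ ρ₂ (m⊔n≤o⇒m≤o _ _ d) s ×-⇔ sat-similar ψ ρ₁ ρ₂ (m⊔n≤o⇒n≤o _ _ d) s
    sat-similar (or φ ψ) ρ₁ ρ₂ d s =
      sat-similar φ ρ₁ ρ₂ (m⊔n≤o⇒m≤o _ _ d) s ⊎-⇔ sat-similar ψ ρ₁ ρ₂ (m⊔n≤o⇒n≤o _ _ d) s
    sat-similar (imp φ ψ) ρ₁ ρ₂ d s =
      →-cong-⇔ (sat-similar φ ρ₁ ρ₂ (m⊔n≤o⇒m≤o _ _ d) s)
               (sat-similar ψ ρ₁ ρ₂ (m⊔n≤o⇒n≤o _ _ d) s)
    sat-similar (all φ) ρ₁ ρ₂ (s≤s d) s = mk⇔
      (λ h y → let x , s′ = Extension.extend em (similar-sym s) y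
               in to (sat-similar φ _ _ d (similar-sym s′)) (h x))
      (λ h x → let y , s′ = Extension.extend em s x in from (sat-similar φ _ _ d s′) (h y))
    sat-similar (ex φ) ρ₁ ρ₂ (s≤s d) s = mk⇔
      (λ (x , h) → let y , s′ = Extension.extend em s x in y , to (sat-similar φ _ _ d s′) h)
      (λ (y , h) → let x , s′ = Extension.extend em (similar-sym s) y
                   in x , from (sat-similar φ _ _ d (similar-sym s′)) h)

    similar⇒elementary : (f : A.Point → B.Point) →
      (∀ k {n} (ρ : Fin n → A.Point) → Similar A B k ρ (f ∘ ρ)) →
      ElementaryEmbedding S₁ S₂
    similar⇒elementary f similar = f , λ n φ ρ →
      let sat⇔ = sat-similar φ ρ (f ∘ ρ) ≤-refl (similar (quantifier-depth φ) ρ) in to sat⇔ , from sat⇔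

module _ {A B : EquivalenceStructure} where
  private
    module A = EquivalenceStructure A
    module B = EquivalenceStructure B

  class-closed-image-similar : (f : A.Point → B.Point) → Injective _≡_ _≡_ f →
    (∀ {x y} → (x A.∼ y) ⇔ (f x B.∼ f y)) → (∀ {x z} → z B.∼ f x → Σ A.Point λ y → f y ≡ z) →
    ∀ k {n} (ρ : Fin n → A.Point) → Similar A B k ρ (f ∘ ρ)
  class-closed-image-similar f f-inj f-∼ closed k ρ = record
    { ≡-similar     = λ i j → mk⇔ (cong f) f-inj
    ; ∼-similar     = λ i j → f-∼
    ; spare-similar = λ i m _ → mk⇔ image preimage
    }
    where
      image : ∀ {i m} → Spare A._∼_ ρ i m → Spare B._∼_ (f ∘ ρ) i m
      image (g , g-inj , g∼ , g∉) = f ∘ g , g-inj ∘ f-inj , to f-∼ ∘ g∼ , λ l j → g∉ l j ∘ f-inj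
      preimage : ∀ {i m} → Spare B._∼_ (f ∘ ρ) i m → Spare A._∼_ ρ i m
      preimage {i} {m} (g , g-inj , g∼ , g∉) = h , h-inj , h∼ , h∉
        where
          h : Fin m → A.Point
          h l = proj₁ (closed (g∼ l))
          fh≡g : ∀ l → f (h l) ≡ g l
          fh≡g l = proj₂ (closed (g∼ l))
          h-inj : Injective _≡_ _≡_ h
          h-inj {a} {b} q = g-inj (trans (sym (fh≡g a)) (trans (cong f q) (fh≡g b)))
          h∼ : ∀ l → h l A.∼ ρ i
          h∼ l = from f-∼ (subst (B._∼ f (ρ i)) (sym (fh≡g l)) (g∼ l))
          h∉ : ∀ l j → h l ≢ ρ j
          h∉ l j q = g∉ l j (trans (sym (fh≡g l)) (cong f q))

Avoiding : (T : Set) → T → ℕ → Set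
Avoiding T t m = Σ (Fin m → T) λ h → Injective _≡_ _≡_ h × (∀ l → h l ≢ t)

avoiding-Fin : ∀ s (j : Fin (suc s)) m → Avoiding (Fin (suc s)) j m ⇔ m ≤ s
avoiding-Fin s j m = mk⇔
  (λ (h , h-inj , h≢j) → injective⇒≤ {f = λ l → punchOut (h≢j l ∘ sym)}
     λ {a} {b} q → h-inj (punchOut-injective (h≢j a ∘ sym) (h≢j b ∘ sym) q))
  (λ m≤s → (λ l → punchIn j (inject≤ l m≤s))
         , (λ {a} {b} q → inject≤-injective m≤s m≤s a b (punchIn-injective j _ _ q))
         , λ l → punchInᵢ≢i j _)

avoiding-ℕ : ∀ t m → Avoiding ℕ t m
avoiding-ℕ t m = (λ l → suc (toℕ l + t))
               , (λ q → toℕ-injective (+-cancelʳ-≡ t _ _ (ℕ.suc-injective q)))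
               , λ l q → m≢1+n+m t (sym q)

upper-bound : ∀ {n} (f : Fin n → ℕ) → Σ ℕ λ N → ∀ j → f j < N
upper-bound {zero}  f = 0 , λ ()
upper-bound {suc n} f =
  let N , f<N = upper-bound (f ∘ suc)
  in suc (f zero) ⊔ N , λ { zero    → m≤m⊔n (suc (f zero)) N
                          ; (suc j) → m<n⇒m<o⊔n (suc (f zero)) (f<N j) }

fresh-ℕ : ∀ {n} (f : Fin n → ℕ) → Σ ℕ λ N → ∀ j → N ≢ f j
fresh-ℕ f = let N , f<N = upper-bound f in N , λ j → >⇒≢ (f<N j)

module Blocks (I : Set) (Block : I → Set)
  (block-profile : ∀ c (e : Block c) →
     (Σ ℕ λ s → ∀ m → Avoiding (Block c) e m ⇔ m ≤ s) ⊎ (∀ m → Avoiding (Block c) e m))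
  (new-block : ∀ {n} (ρ : Fin n → I) s → Σ I λ c → (∀ j → c ≢ ρ j) ×
     Σ (Block c) λ e → ∀ m → Avoiding (Block c) e m ⇔ m ≤ s)
  where

  Point : Set
  Point = Σ I Block

  _∼_ : Point → Point → Set
  x ∼ y = proj₁ x ≡ proj₁ y

  in-block : ∀ {c} (y : Point) → proj₁ y ≡ c → Σ (Block c) λ e → (c , e) ≡ y
  in-block (c , e) refl = e , refl

  mates-avoiding : ∀ c (e : Block c) m → Mates _∼_ (c , e) m ⇔ Avoiding (Block c) e m
  mates-avoiding c e m = mk⇔ inside
    (λ (h , h-inj , h≢) → (c ,_) ∘ h , h-inj ∘ ,-injective , (λ l → refl) , λ l → h≢ l ∘ ,-injective)
    where
      inside : Mates _∼_ (c , e) m → Avoiding (Block c) e m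
      inside (g , g-inj , g∼ , g≢) = h , h-inj , λ l q → g≢ l (trans (sym (ch≡g l)) (cong (c ,_) q))
        where
          h : Fin m → Block c
          h l = proj₁ (in-block (g l) (g∼ l))
          ch≡g : ∀ l → (c , h l) ≡ g l
          ch≡g l = proj₂ (in-block (g l) (g∼ l))
          h-inj : Injective _≡_ _≡_ h
          h-inj {a} {b} q = g-inj (trans (sym (ch≡g a)) (trans (cong (c ,_) q) (ch≡g b)))
      ,-injective : ∀ {a b : Block c} → _≡_ {A = Point} (c , a) (c , b) → a ≡ b
      ,-injective refl = refl

  blocks : EquivalenceStructure
  blocks = record
    { Point         = Point
    ; _∼_           = _∼_
    ; isEquivalence = record { refl = refl ; sym = sym ; trans = trans }
    ; mates-profile = mates-profile
    ; new-class     = new-class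
    }
    where
      mates-profile : ∀ x → (Σ ℕ λ s → ∀ m → Mates _∼_ x m ⇔ m ≤ s) ⊎ (∀ m → Mates _∼_ x m)
      mates-profile (c , e) with block-profile c e
      ... | inj₁ (s , avoiding⇔) = inj₁ (s , λ m → mates-avoiding c e m ⟨⇔⟩ avoiding⇔ m)
      ... | inj₂ avoiding         = inj₂ λ m → from (mates-avoiding c e m) (avoiding m)
      new-class : ∀ {n} (ρ : Fin n → Point) s →
        Σ Point λ y → (∀ j → ¬ y ∼ ρ j) × (∀ m → Mates _∼_ y m ⇔ m ≤ s)
      new-class ρ s =
        let c , c-new , e , avoiding⇔ = new-block (proj₁ ∘ ρ) s
        in (c , e) , c-new , λ m → mates-avoiding c e m ⟨⇔⟩ avoiding⇔ m

-- The tag t of a block index (t , s) only serves to supply infinitely many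
-- blocks of size s + 1.
FiniteBlock : ℕ × ℕ → Set
FiniteBlock (t , s) = Fin (suc s)

finite-block-profile : ∀ c (e : FiniteBlock c) → Σ ℕ λ s → ∀ m → Avoiding (FiniteBlock c) e m ⇔ m ≤ s
finite-block-profile (t , s) e = s , avoiding-Fin s e

Index₂ : Set
Index₂ = (ℕ × ℕ) ⊎ ⊤

Block₂ : Index₂ → Set
Block₂ (inj₁ c) = FiniteBlock c
Block₂ (inj₂ _) = ℕ

tag₂ : Index₂ → ℕ
tag₂ (inj₁ (t , s)) = t
tag₂ (inj₂ _)       = 0

new-finite-block : ∀ {n} (ρ : Fin n → ℕ × ℕ) s → Σ (ℕ × ℕ) λ c → (∀ j → c ≢ ρ j) ×
  Σ (FiniteBlock c) λ e → ∀ m → Avoiding (FiniteBlock c) e m ⇔ m ≤ s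
new-finite-block ρ s =
  let t , t-new = fresh-ℕ (proj₁ ∘ ρ)
  in (t , s) , (λ j → t-new j ∘ cong proj₁) , zero , avoiding-Fin s zero

module B₁ = Blocks (ℕ × ℕ) FiniteBlock (λ c e → inj₁ (finite-block-profile c e)) new-finite-block

block₂-profile : ∀ c (e : Block₂ c) →
  (Σ ℕ λ s → ∀ m → Avoiding (Block₂ c) e m ⇔ m ≤ s) ⊎ (∀ m → Avoiding (Block₂ c) e m)
block₂-profile (inj₁ c) e = inj₁ (finite-block-profile c e)
block₂-profile (inj₂ _) e = inj₂ (avoiding-ℕ e)

new-block₂ : ∀ {n} (ρ : Fin n → Index₂) s → Σ Index₂ λ c → (∀ j → c ≢ ρ j) ×
  Σ (Block₂ c) λ e → ∀ m → Avoiding (Block₂ c) e m ⇔ m ≤ s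
new-block₂ ρ s =
  let t , t-new = fresh-ℕ (tag₂ ∘ ρ)
  in inj₁ (t , s) , (λ j → t-new j ∘ cong tag₂) , zero , avoiding-Fin s zero

module B₂ = Blocks Index₂ Block₂ block₂-profile new-block₂

M₁ M₂ : Structure vocabulary
M₁ = structure B₁.blocks
M₂ = structure B₂.blocks

M₁≼M₂ : ExcludedMiddle 0ℓ → ElementaryEmbedding (toSetoid M₁) (toSetoid M₂)
M₁≼M₂ em = similar⇒elementary em include
  (class-closed-image-similar include include-injective (mk⇔ (cong inj₁) inj₁-injective)
                              (λ {x} → closed {x}))
  where
    include : B₁.Point → B₂.Point
    include (c , e) = inj₁ c , e
    include-injective : Injective _≡_ _≡_ include
    include-injective {c , e} {.c , .e} refl = refl
    inj₁-injective : ∀ {a b : ℕ × ℕ} → _≡_ {A = Index₂} (inj₁ a) (inj₁ b) → a ≡ b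
    inj₁-injective refl = refl
    closed : ∀ {x z} → proj₁ z ≡ proj₁ (include x) → Σ B₁.Point λ y → include y ≡ z
    closed {z = inj₁ c , e} refl = (c , e) , refl

module _ {M : Set} where
  open Ultrafilter

  principal : ExcludedMiddle 0ℓ → M → Ultrafilter M
  principal em a = record
    { filter = record
        { mem = λ X → X a ; whole = tt ; proper = λ () ; upward = λ X⊆Y → X⊆Y ; inter = _,_ }
    ; ultra  = λ X → toSum (em {X a})
    }

  Principal : Ultrafilter M → Set
  Principal D = Σ M λ a → mem D (_≡ a)

  Apart : Ultrafilter M → Set
  Apart D = mem D λ a → mem D λ b → a ≢ b

  mem⇒nonempty : ExcludedMiddle 0ℓ → (D : Ultrafilter M) {X : Pred M 0ℓ} → mem D X → Σ M X
  mem⇒nonempty em D {X} X∈D with em {Σ M X}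
  ... | yes x = x
  ... | no ¬x = ⊥-elim (proper D (upward D (λ {a} a∈X → ¬x (a , a∈X)) X∈D))

  finite-mem⇒principal : (D : Ultrafilter M) → ∀ n (g : Fin n → M) →
    mem D (λ b → Σ (Fin n) λ l → b ≡ g l) → Principal D
  finite-mem⇒principal D zero    g range∈D = ⊥-elim (proper D (upward D (λ { (() , _) }) range∈D))
  finite-mem⇒principal D (suc n) g range∈D with ultra D (_≡ g zero)
  ... | inj₁ head∈D = g zero , head∈D
  ... | inj₂ ¬head∈D = finite-mem⇒principal D n (g ∘ suc) (upward D tail (inter D ¬head∈D range∈D))
    where
      tail : ∀ {b} → b ≢ g zero × (Σ (Fin (suc n)) λ l → b ≡ g l) → Σ (Fin n) λ l → b ≡ g (suc l)
      tail (b≢ , zero  , q) = ⊥-elim (b≢ q)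
      tail (b≢ , suc l , q) = l , q

  principal⇒¬apart : ExcludedMiddle 0ℓ → (D : Ultrafilter M) → Principal D → ¬ Apart D
  principal⇒¬apart em D (a , a∈D) apart = proper D (upward D a≢a (inter D a-apart a∈D))
    where
      a-apart : mem D (a ≢_)
      a-apart = proj₂ (mem⇒nonempty em D (upward D moved (inter D apart a∈D)))
        where
          moved : ∀ {b} → mem D (b ≢_) × b ≡ a → mem D (a ≢_)
          moved (b-apart , b≡a) = subst (λ c → mem D (c ≢_)) b≡a b-apart
      a≢a : ∀ {b} → a ≢ b × b ≡ a → ⊥
      a≢a (a≢b , b≡a) = a≢b (sym b≡a)

  tail-filter : (ℕ → M) → Filter M
  tail-filter ι = record
    { mem    = λ X → Σ ℕ λ N → ∀ t → N ≤ t → X (ι t)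
    ; whole  = 0 , λ _ _ → tt
    ; proper = λ (N , h) → h N ≤-refl
    ; upward = λ X⊆Y (N , h) → N , λ t N≤t → X⊆Y (h t N≤t)
    ; inter  = λ (N , h) (N₂ , h₂) → N ⊔ N₂ , λ t N⊔N₂≤t →
        h t (m⊔n≤o⇒m≤o N N₂ N⊔N₂≤t) , h₂ t (m⊔n≤o⇒n≤o N N₂ N⊔N₂≤t)
    }

  injective-sequence-ultrafilter : ExcludedMiddle 0ℓ → UltrafilterLemma →
    (ι : ℕ → M) → Injective _≡_ _≡_ ι →
    Σ (Ultrafilter M) λ D → (∀ {X} → Filter.mem (tail-filter ι) X → mem D X) × Apart D
  injective-sequence-ultrafilter em ultrafilter-lemma ι ι-inj with ultrafilter-lemma (tail-filter ι)
  ... | D , extends = D , extends , upward D (λ {a} _ → extends (cofinite a)) (whole D)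
    where
      cofinite : ∀ a → Filter.mem (tail-filter ι) (a ≢_)
      cofinite a with em {Σ ℕ λ t₀ → ι t₀ ≡ a}
      ... | yes (t₀ , ιt₀≡a) = suc t₀ , λ t t₀<t a≡ιt →
                                 1+n≰n (subst (suc t₀ ≤_) (ι-inj (trans (sym a≡ιt) (sym ιt₀≡a))) t₀<t)
      ... | no a∉ι          = 0 , λ t _ a≡ιt → a∉ι (t , sym a≡ιt)

-- ∃ x ∃ y (y ≢ y ∧ x ∼ y); the innermost variable is var zero.
nonprincipal-classmate : Sentence vocabulary
nonprincipal-classmate =
  ex (ex (and (rel distinct λ _ → var zero)
              (rel classmate λ { zero → var (suc zero) ; (suc zero) → var zero })))

module _ (em : ExcludedMiddle 0ℓ) where

  β-M₁-classmate-principal : (x y : Ultrafilter B₁.Point) →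
    Ultrafilter.mem x (λ a → Ultrafilter.mem y (a B₁.∼_)) → Principal y
  β-M₁-classmate-principal x y x∼y with mem⇒nonempty em x x∼y
  ... | (c , _) , class∈y =
    finite-mem⇒principal y (suc (proj₂ c)) (c ,_) (Ultrafilter.upward y in-class class∈y)
    where
      in-class : ∀ {b} → c ≡ proj₁ b → Σ (Fin (suc (proj₂ c))) λ l → b ≡ (c , l)
      in-class {b} c≡b = let l , q = B₁.in-block b (sym c≡b) in l , sym q

  β-M₁-⊭ : ¬ _⊨_ (β em M₁) nonprincipal-classmate
  β-M₁-⊭ (x , y , lift y-apart , lift x∼y) =
    principal⇒¬apart em y (β-M₁-classmate-principal x y x∼y) y-apart

  β-M₂-⊨ : UltrafilterLemma → _⊨_ (β em M₂) nonprincipal-classmate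
  β-M₂-⊨ ultrafilter-lemma
    with injective-sequence-ultrafilter em ultrafilter-lemma (inj₂ tt ,_) (λ { refl → refl })
  ... | D , extends , D-apart =
    principal em (inj₂ tt , 0) , D , lift D-apart , lift (extends (0 , λ t _ → refl))

theorem2 : (lem : (ℓ : Level) → ExcludedMiddle ℓ) → UltrafilterLemma →
    Σ Vocabulary λ σ → Σ (Structure σ) λ M₁ → Σ (Structure σ) λ M₂ →
      Carrier M₁ × Carrier M₂ ×
      ElementaryEmbedding (toSetoid M₁) (toSetoid M₂) ×
      ¬ ElementarilyEquivalent (β (lem 0ℓ) M₁) (β (lem 0ℓ) M₂)
theorem2 lem ultrafilter-lemma =
  vocabulary , M₁ , M₂ , ((0 , 0) , zero) , (inj₂ tt , 0) , M₁≼M₂ (lem 0ℓ) ,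
  λ β-equivalent → β-M₁-⊭ (lem 0ℓ)
    (proj₂ (β-equivalent nonprincipal-classmate) (β-M₂-⊨ (lem 0ℓ) ultrafilter-lemma))
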